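{- Let $q$ be a positive integer. Every $((q + 1) \times q^2,\ q(q + 1))$-unordered triple array is resolvable.
   Context: An $(r \times c, v)$-unordered triple array on a set $V$ of $v$ symbols is a collection of $c$-subsets $R_1, \dots, R_r \subseteq V$ (row-sets) and $r$-subsets $C_1, \dots, C_c \subseteq V$ (column-sets) such that, for some integers $e, \lambda_{rc}, \lambda_{rr}, \lambda_{cc}$, each symbol lies in exactly $e$ row-sets and exactly $e$ column-sets, $|R_i \cap C_j| = \lambda_{rc}$ for all $i,j$, $|R_i \cap R_s| = \lambda_{rr}$ for all $i \neq s$, and $|C_j \cap C_t| = \lambda_{cc}$ for all $j \neq t$. Necessarily $e = rc/v$. Such an unordered triple array is called resolvable if $\lambda_{rrc} := \frac{e(e-1)}{r-1}$ and $k := \frac{c}{e}$ are integers and the symbol set can be partitioned into $r$ groups of size $k$ such that every column-set contains exactly one symbol from each group, and all symbols of a group lie in exactly the same row-sets. -}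

module Defs where

open import Data.Nat using (ℕ; _*_; _∸_; _+_)
open import Data.Nat.Divisibility using (_∣_)
open import Data.Fin using (Fin; _≟_)
open import Data.Fin.Subset using (Subset; ∣_∣; _∩_; _∈_)
open import Data.Vec using (lookup; tabulate)
open import Data.Product using (Σ; _×_)
open import Relation.Nullary using (does)
open import Relation.Binary.PropositionalEquality using (_≡_; _≢_)
open import Function.Bundles using (_⇔_)

occurrences : {r v : ℕ} → (Fin r → Subset v) → Fin v → ℕ
occurrences {r} S x = ∣ tabulate (λ i → lookup (S i) x) ∣

-- An (r × c, v)-unordered triple array on the symbol set Fin v,
-- given by row-sets R and column-sets C, with parameters e, λrc, λrr, λcc.
record IsUTA (r c v : ℕ) (R : Fin r → Subset v) (C : Fin c → Subset v)
             (e λrc λrr λcc : ℕ) : Set where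
  field
    row-size   : ∀ i → ∣ R i ∣ ≡ c
    col-size   : ∀ j → ∣ C j ∣ ≡ r
    row-rep    : ∀ x → occurrences R x ≡ e
    col-rep    : ∀ x → occurrences C x ≡ e
    row-col    : ∀ i j → ∣ R i ∩ C j ∣ ≡ λrc
    row-row    : ∀ i s → i ≢ s → ∣ R i ∩ R s ∣ ≡ λrr
    col-col    : ∀ j t → t ≢ j → ∣ C j ∩ C t ∣ ≡ λcc

UTA : (r c v : ℕ) → (Fin r → Subset v) → (Fin c → Subset v) → Set
UTA r c v R C = Σ ℕ λ e → Σ ℕ λ λrc → Σ ℕ λ λrr → Σ ℕ λ λcc → IsUTA r c v R C e λrc λrr λcc

group : {v r : ℕ} → (Fin v → Fin r) → Fin r → Subset v
group g i = tabulate (λ x → does (g x ≟ i))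

-- e is forced to be rc/v (e * v = r * c).
record IsResolvable (r c v : ℕ) (R : Fin r → Subset v) (C : Fin c → Subset v)
                    (e : ℕ) : Set where
  field
    λrrc-integral : (r ∸ 1) ∣ (e * (e ∸ 1))
    k             : ℕ
    k-def         : c ≡ k * e
    g             : Fin v → Fin r
    group-size    : ∀ i → ∣ group g i ∣ ≡ k
    col-transversal : ∀ j i → ∣ C j ∩ group g i ∣ ≡ 1
    same-rows     : ∀ x y → g x ≡ g y → ∀ i → (x ∈ R i) ⇔ (y ∈ R i)

Resolvable : (r c v : ℕ) → (Fin r → Subset v) → (Fin c → Subset v) → Set
Resolvable r c v R C = Σ ℕ λ e → (e * v ≡ r * c) × IsResolvable r c v R C e

{-# OPTIONS --safe #-}
-- Double counting the incidences of symbols with row-sets gives e v = r c, which for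
-- r = q + 1, c = q², v = q(q + 1) forces e = q = r - 1; double counting R i against the
-- column-sets gives λrc = e. So every symbol misses exactly one row-set, and grouping the
-- symbols by the row-set they miss makes the groups the complements of the row-sets.
-- A column-set has e + 1 symbols, e of them in R i, so it meets the complement of R i once.
module Submission where

open import Defs
open import Data.Nat using (ℕ; zero; suc; _*_; _+_; _∸_; _≤_; NonZero; >-nonZero)
open import Data.Nat.Properties
  using (+-*-semiring; +-identityʳ; +-suc; suc-injective; *-comm; *-assoc; *-distribʳ-+;
         *-distribʳ-∸; *-identityˡ; *-cancelʳ-≡; *-cancelˡ-≡; +-cancelˡ-≡; m+n∸m≡n; m+n∸n≡m;
         m≤n⇒m≤n+o; m*n≢0)
open import Data.Nat.Divisibility using (_∣_; m∣m*n)
open import Data.Bool using (Bool; true; false; not; _∧_)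
open import Data.Bool.Properties using (not-involutive)
open import Data.Fin using (Fin; zero; suc; _≟_)
open import Data.Fin.Properties using (nonZeroIndex)
open import Data.Fin.Subset using (Subset; inside; outside; ∣_∣; _∩_; _∈_; ∁; ⊤; ⊥; ⁅_⁆)
open import Data.Fin.Subset.Properties using (∣⊤∣≡n; ∣∁p∣≡n∸∣p∣; ∩-identityˡ; ∩-comm)
open import Data.Vec using (_∷_; []; lookup; tabulate)
open import Data.Vec.Properties
  using (lookup-map; lookup-zipWith; lookup-replicate; lookup∘tabulate; tabulate∘lookup;
         tabulate-cong; []=⇒lookup; lookup⇒[]=)
open import Data.Product using (∃-syntax; _,_; proj₁; proj₂)
open import Relation.Nullary using (does)
open import Relation.Binary.PropositionalEquality
  using (_≡_; refl; sym; trans; cong; cong₂; subst; module ≡-Reasoning)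
open import Function using (_∘_; _⇔_; mk⇔)
open import Algebra.Properties.Semiring.Sum +-*-semiring
  using (sum-syntax; ∑-comm; sum-cong-≗; *-distribˡ-sum; *-distribʳ-sum)

open ≡-Reasoning

[_] : Bool → ℕ
[ false ] = 0
[ true ]  = 1

[a∧b]≡[a]*[b] : ∀ a b → [ a ∧ b ] ≡ [ a ] * [ b ]
[a∧b]≡[a]*[b] false b = refl
[a∧b]≡[a]*[b] true  b = sym (+-identityʳ [ b ])

∑-const : ∀ n x → ∑[ i < n ] x ≡ n * x
∑-const zero    x = refl
∑-const (suc n) x = cong (x +_) (∑-const n x)

∣p∣≡∑[p] : ∀ {n} (p : Subset n) → ∣ p ∣ ≡ ∑[ x < n ] [ lookup p x ]
∣p∣≡∑[p] []            = refl
∣p∣≡∑[p] (inside ∷ p)  = cong suc (∣p∣≡∑[p] p)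
∣p∣≡∑[p] (outside ∷ p) = ∣p∣≡∑[p] p

∣p∩q∣≡∑[p]*[q] : ∀ {n} (p q : Subset n) → ∣ p ∩ q ∣ ≡ ∑[ x < n ] ([ lookup p x ] * [ lookup q x ])
∣p∩q∣≡∑[p]*[q] p q = trans (∣p∣≡∑[p] (p ∩ q)) (sum-cong-≗ λ x →
  trans (cong [_] (lookup-zipWith _∧_ x p q)) ([a∧b]≡[a]*[b] (lookup p x) (lookup q x)))

incidence : ∀ {m n} → (Fin m → Subset n) → Fin n → Subset m
incidence S x = tabulate (λ i → lookup (S i) x)

lookup-incidence : ∀ {m n} (S : Fin m → Subset n) x i → lookup (incidence S x) i ≡ lookup (S i) x
lookup-incidence S x = lookup∘tabulate (λ i → lookup (S i) x)

occurrences≡∑ : ∀ {m n} (S : Fin m → Subset n) x → occurrences S x ≡ ∑[ i < m ] [ lookup (S i) x ]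
occurrences≡∑ S x = trans (∣p∣≡∑[p] (incidence S x)) (sum-cong-≗ (cong [_] ∘ lookup-incidence S x))

∑∣p∩S∣≡∑[p]*occurrences : ∀ {m n} (p : Subset n) (S : Fin m → Subset n) →
  ∑[ j < m ] ∣ p ∩ S j ∣ ≡ ∑[ x < n ] ([ lookup p x ] * occurrences S x)
∑∣p∩S∣≡∑[p]*occurrences {m} {n} p S = begin
  ∑[ j < m ] ∣ p ∩ S j ∣
    ≡⟨ sum-cong-≗ (∣p∩q∣≡∑[p]*[q] p ∘ S) ⟩
  ∑[ j < m ] ∑[ x < n ] ([ lookup p x ] * [ lookup (S j) x ])
    ≡⟨ ∑-comm (λ j x → [ lookup p x ] * [ lookup (S j) x ]) ⟩
  ∑[ x < n ] ∑[ j < m ] ([ lookup p x ] * [ lookup (S j) x ])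
    ≡⟨ sum-cong-≗ (λ x → sym (*-distribˡ-sum [ lookup p x ] (λ j → [ lookup (S j) x ]))) ⟩
  ∑[ x < n ] ([ lookup p x ] * ∑[ j < m ] [ lookup (S j) x ])
    ≡⟨ sum-cong-≗ (λ x → cong ([ lookup p x ] *_) (sym (occurrences≡∑ S x))) ⟩
  ∑[ x < n ] ([ lookup p x ] * occurrences S x)
    ∎

∑∣p∩S∣≡∣p∣*e : ∀ {m n e} (p : Subset n) (S : Fin m → Subset n) →
  (∀ x → occurrences S x ≡ e) → ∑[ j < m ] ∣ p ∩ S j ∣ ≡ ∣ p ∣ * e
∑∣p∩S∣≡∣p∣*e {m} {n} {e} p S rep = begin
  ∑[ j < m ] ∣ p ∩ S j ∣
    ≡⟨ ∑∣p∩S∣≡∑[p]*occurrences p S ⟩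
  ∑[ x < n ] ([ lookup p x ] * occurrences S x)
    ≡⟨ sum-cong-≗ (λ x → cong ([ lookup p x ] *_) (rep x)) ⟩
  ∑[ x < n ] ([ lookup p x ] * e)
    ≡⟨ sym (*-distribʳ-sum e (λ x → [ lookup p x ])) ⟩
  ∑[ x < n ] [ lookup p x ] * e
    ≡⟨ cong (_* e) (sym (∣p∣≡∑[p] p)) ⟩
  ∣ p ∣ * e
    ∎

∑∣S∣≡n*e : ∀ {m n e} (S : Fin m → Subset n) →
  (∀ x → occurrences S x ≡ e) → ∑[ j < m ] ∣ S j ∣ ≡ n * e
∑∣S∣≡n*e {m} {n} {e} S rep = begin
  ∑[ j < m ] ∣ S j ∣     ≡⟨ sum-cong-≗ (cong ∣_∣ ∘ sym ∘ ∩-identityˡ ∘ S) ⟩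
  ∑[ j < m ] ∣ ⊤ ∩ S j ∣ ≡⟨ ∑∣p∩S∣≡∣p∣*e ⊤ S rep ⟩
  ∣ ⊤ {n} ∣ * e          ≡⟨ cong (_* e) (∣⊤∣≡n n) ⟩
  n * e                  ∎

∣p∣≡0⇒p≡⊥ : ∀ {n} (p : Subset n) → ∣ p ∣ ≡ 0 → p ≡ ⊥
∣p∣≡0⇒p≡⊥ []            _     = refl
∣p∣≡0⇒p≡⊥ (inside ∷ p)  ()
∣p∣≡0⇒p≡⊥ (outside ∷ p) ∣p∣≡0 = cong (outside ∷_) (∣p∣≡0⇒p≡⊥ p ∣p∣≡0)

∣p∣≡1⇒p≡⁅x⁆ : ∀ {n} (p : Subset n) → ∣ p ∣ ≡ 1 → ∃[ x ] p ≡ ⁅ x ⁆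
∣p∣≡1⇒p≡⁅x⁆ (inside ∷ p)  ∣p∣≡1 = zero , cong (inside ∷_) (∣p∣≡0⇒p≡⊥ p (suc-injective ∣p∣≡1))
∣p∣≡1⇒p≡⁅x⁆ (outside ∷ p) ∣p∣≡1 =
  let x , p≡⁅x⁆ = ∣p∣≡1⇒p≡⁅x⁆ p ∣p∣≡1 in suc x , cong (outside ∷_) p≡⁅x⁆

lookup-⁅⁆ : ∀ {n} (x i : Fin n) → lookup ⁅ x ⁆ i ≡ does (x ≟ i)
lookup-⁅⁆ zero    zero    = refl
lookup-⁅⁆ zero    (suc i) = lookup-replicate i outside
lookup-⁅⁆ (suc x) zero    = refl
lookup-⁅⁆ (suc x) (suc i) = lookup-⁅⁆ x i

∣p∩q∣+∣p∩∁q∣≡∣p∣ : ∀ {n} (p q : Subset n) → ∣ p ∩ q ∣ + ∣ p ∩ ∁ q ∣ ≡ ∣ p ∣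
∣p∩q∣+∣p∩∁q∣≡∣p∣ []            []            = refl
∣p∩q∣+∣p∩∁q∣≡∣p∣ (outside ∷ p) (_ ∷ q)       = ∣p∩q∣+∣p∩∁q∣≡∣p∣ p q
∣p∩q∣+∣p∩∁q∣≡∣p∣ (inside ∷ p)  (inside ∷ q)  = cong suc (∣p∩q∣+∣p∩∁q∣≡∣p∣ p q)
∣p∩q∣+∣p∩∁q∣≡∣p∣ (inside ∷ p)  (outside ∷ q) =
  trans (+-suc ∣ p ∩ q ∣ ∣ p ∩ ∁ q ∣) (cong suc (∣p∩q∣+∣p∩∁q∣≡∣p∣ p q))

module MissedBlock {e n} (S : Fin (e + 1) → Subset n) (rep : ∀ x → occurrences S x ≡ e) where

  private
    ∣∁incidence∣≡1 : ∀ x → ∣ ∁ (incidence S x) ∣ ≡ 1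
    ∣∁incidence∣≡1 x = begin
      ∣ ∁ (incidence S x) ∣   ≡⟨ ∣∁p∣≡n∸∣p∣ (incidence S x) ⟩
      e + 1 ∸ occurrences S x ≡⟨ cong (e + 1 ∸_) (rep x) ⟩
      e + 1 ∸ e               ≡⟨ m+n∸m≡n e 1 ⟩
      1                       ∎

    missed : ∀ x → ∃[ i ] ∁ (incidence S x) ≡ ⁅ i ⁆
    missed x = ∣p∣≡1⇒p≡⁅x⁆ (∁ (incidence S x)) (∣∁incidence∣≡1 x)

  missedBlock : Fin n → Fin (e + 1)
  missedBlock x = proj₁ (missed x)

  lookup-missedBlock : ∀ i x → lookup (S i) x ≡ not (does (missedBlock x ≟ i))
  lookup-missedBlock i x = begin
    lookup (S i) x                          ≡⟨ sym (lookup-incidence S x i) ⟩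
    lookup (incidence S x) i                ≡⟨ sym (not-involutive _) ⟩
    not (not (lookup (incidence S x) i))    ≡⟨ cong not (sym (lookup-map i not (incidence S x))) ⟩
    not (lookup (∁ (incidence S x)) i)      ≡⟨ cong (λ p → not (lookup p i)) (proj₂ (missed x)) ⟩
    not (lookup ⁅ missedBlock x ⁆ i)        ≡⟨ cong not (lookup-⁅⁆ (missedBlock x) i) ⟩
    not (does (missedBlock x ≟ i))          ∎

  group-missedBlock : ∀ i → group missedBlock i ≡ ∁ (S i)
  group-missedBlock i = trans (tabulate-cong does≡lookup∁) (tabulate∘lookup (∁ (S i)))
    where
    does≡lookup∁ : ∀ x → does (missedBlock x ≟ i) ≡ lookup (∁ (S i)) x
    does≡lookup∁ x = begin
      does (missedBlock x ≟ i)             ≡⟨ sym (not-involutive _) ⟩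
      not (not (does (missedBlock x ≟ i))) ≡⟨ cong not (sym (lookup-missedBlock i x)) ⟩
      not (lookup (S i) x)                 ≡⟨ sym (lookup-map x not (S i)) ⟩
      lookup (∁ (S i)) x                   ∎

  missedBlock-same-blocks : ∀ x y → missedBlock x ≡ missedBlock y → ∀ i → x ∈ S i ⇔ y ∈ S i
  missedBlock-same-blocks x y gx≡gy i =
    mk⇔ (transport lookup-x≡lookup-y) (transport (sym lookup-x≡lookup-y))
    where
    lookup-x≡lookup-y : lookup (S i) x ≡ lookup (S i) y
    lookup-x≡lookup-y = begin
      lookup (S i) x                 ≡⟨ lookup-missedBlock i x ⟩
      not (does (missedBlock x ≟ i)) ≡⟨ cong (λ b → not (does (b ≟ i))) gx≡gy ⟩
      not (does (missedBlock y ≟ i)) ≡⟨ sym (lookup-missedBlock i y) ⟩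
      lookup (S i) y                 ∎
    transport : ∀ {a b} → lookup (S i) a ≡ lookup (S i) b → a ∈ S i → b ∈ S i
    transport {a} {b} eq a∈S = lookup⇒[]= b (S i) (trans (sym eq) ([]=⇒lookup a∈S))

module _ {r c v} {R : Fin r → Subset v} {C : Fin c → Subset v} {e λrc λrr λcc}
         (uta : IsUTA r c v R C e λrc λrr λcc) where
  open IsUTA uta

  e*v≡r*c : e * v ≡ r * c
  e*v≡r*c = begin
    e * v              ≡⟨ *-comm e v ⟩
    v * e              ≡⟨ sym (∑∣S∣≡n*e R row-rep) ⟩
    ∑[ i < r ] ∣ R i ∣ ≡⟨ sum-cong-≗ row-size ⟩
    ∑[ i < r ] c       ≡⟨ ∑-const r c ⟩
    r * c              ∎

  λrc≡e : Fin r → Fin c → λrc ≡ e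
  λrc≡e i j = *-cancelˡ-≡ λrc e c {{nonZeroIndex j}} (begin
    c * λrc                  ≡⟨ sym (∑-const c λrc) ⟩
    ∑[ j < c ] λrc           ≡⟨ sum-cong-≗ (sym ∘ row-col i) ⟩
    ∑[ j < c ] ∣ R i ∩ C j ∣ ≡⟨ ∑∣p∩S∣≡∣p∣*e (R i) C col-rep ⟩
    ∣ R i ∣ * e              ≡⟨ cong (_* e) (row-size i) ⟩
    c * e                    ∎)

c≡[v∸c]*e : ∀ e c v → e * v ≡ (e + 1) * c → c ≡ (v ∸ c) * e
c≡[v∸c]*e e c v e*v≡[e+1]*c = sym (begin
  (v ∸ c) * e           ≡⟨ *-distribʳ-∸ e v c ⟩
  v * e ∸ c * e         ≡⟨ cong₂ _∸_ (*-comm v e) (*-comm c e) ⟩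
  e * v ∸ e * c         ≡⟨ cong (_∸ e * c) e*v≡[e+1]*c ⟩
  (e + 1) * c ∸ e * c   ≡⟨ cong (_∸ e * c) (*-distribʳ-+ c e 1) ⟩
  e * c + 1 * c ∸ e * c ≡⟨ m+n∸m≡n (e * c) (1 * c) ⟩
  1 * c                 ≡⟨ *-identityˡ c ⟩
  c                     ∎)

e+1-rows⇒resolvable : ∀ {e c v R C λrc λrr λcc} →
  IsUTA (e + 1) c v R C e λrc λrr λcc → Resolvable (e + 1) c v R C
e+1-rows⇒resolvable {e} {c} {v} {R} {C} uta = e , e*v≡r*c uta , record
  { λrrc-integral   = subst (_∣ e * (e ∸ 1)) (sym (m+n∸n≡m e 1)) (m∣m*n (e ∸ 1))
  ; k               = v ∸ c
  ; k-def           = c≡[v∸c]*e e c v (e*v≡r*c uta)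
  ; g               = missedBlock
  ; group-size      = group-size
  ; col-transversal = col-transversal
  ; same-rows       = missedBlock-same-blocks
  }
  where
  open IsUTA uta
  open MissedBlock R row-rep

  group-size : ∀ i → ∣ group missedBlock i ∣ ≡ v ∸ c
  group-size i = begin
    ∣ group missedBlock i ∣ ≡⟨ cong ∣_∣ (group-missedBlock i) ⟩
    ∣ ∁ (R i) ∣             ≡⟨ ∣∁p∣≡n∸∣p∣ (R i) ⟩
    v ∸ ∣ R i ∣             ≡⟨ cong (v ∸_) (row-size i) ⟩
    v ∸ c                   ∎

  col-transversal : ∀ j i → ∣ C j ∩ group missedBlock i ∣ ≡ 1
  col-transversal j i = +-cancelˡ-≡ e _ _ (begin
    e + ∣ C j ∩ group missedBlock i ∣
      ≡⟨ cong₂ (λ a b → a + ∣ C j ∩ b ∣) (sym ∣C∩R∣≡e) (group-missedBlock i) ⟩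
    ∣ C j ∩ R i ∣ + ∣ C j ∩ ∁ (R i) ∣ ≡⟨ ∣p∩q∣+∣p∩∁q∣≡∣p∣ (C j) (R i) ⟩
    ∣ C j ∣                           ≡⟨ col-size j ⟩
    e + 1                             ∎)
    where
    ∣C∩R∣≡e : ∣ C j ∩ R i ∣ ≡ e
    ∣C∩R∣≡e = trans (cong ∣_∣ (∩-comm (C j) (R i))) (trans (row-col i j) (λrc≡e uta i j))

theorem10 : (q : ℕ) → 1 ≤ q →
    (R : Fin (q + 1) → Subset (q * (q + 1))) → (C : Fin (q * q) → Subset (q * (q + 1))) →
    UTA (q + 1) (q * q) (q * (q + 1)) R C → Resolvable (q + 1) (q * q) (q * (q + 1)) R C
theorem10 q 1≤q R C (e , λrc , λrr , λcc , uta) =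
  e+1-rows⇒resolvable (subst (λ e → IsUTA (q + 1) (q * q) (q * (q + 1)) R C e λrc λrr λcc) e≡q uta)
  where
  v≢0 : NonZero (q * (q + 1))
  v≢0 = m*n≢0 q (q + 1) {{>-nonZero 1≤q}} {{>-nonZero (m≤n⇒m≤n+o 1 1≤q)}}

  e≡q : e ≡ q
  e≡q = *-cancelʳ-≡ e q (q * (q + 1)) {{v≢0}} (begin
    e * (q * (q + 1)) ≡⟨ e*v≡r*c uta ⟩
    (q + 1) * (q * q) ≡⟨ sym (*-assoc (q + 1) q q) ⟩
    (q + 1) * q * q   ≡⟨ cong (_* q) (*-comm (q + 1) q) ⟩
    q * (q + 1) * q   ≡⟨ *-comm (q * (q + 1)) q ⟩
    q * (q * (q + 1)) ∎)
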